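{- Let $N,n,k$ be positive integers and let $\mathcal{C}\subset 2^{[N]}$ be a simplicial complex such that every inclusion-maximal set of $\mathcal{C}$ has size at least $n$. Then $\mathcal{C}^{(k)}$ is $\big(\frac nk, k\big)$-spread.
   Context: A simplicial complex $\mathcal{C}\subset 2^{[N]}$ is a family such that $A\in\mathcal{C}$ and $B\subset A$ imply $B\in\mathcal{C}$. $\mathcal{C}^{(k)}$ denotes the subfamily of all $k$-element sets of $\mathcal{C}$. For a family $\mathcal{A}$ and a set $X$, $\mathcal{A}(X)=\{F\setminus X: F\in\mathcal{A}, X\subset F\}$. A family $\mathcal{A}$ is $r$-spread if $|\mathcal{A}(X)|\le r^{ -|X|}|\mathcal{A}|$ for every set $X$. A family $\mathcal{A}\subset 2^{[N]}$ is $(r,q)$-spread if for every $S\subset[N]$ with $|S|\le q$, the family $\mathcal{A}(S)$ is $r$-spread. -}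

module Defs where

open import Data.Bool using (Bool; true; false; T; _∧_; if_then_else_)
import Data.Bool as B
open import Data.Nat using (ℕ; zero; suc; _+_; _*_; _^_; _≤_; _≟_)
open import Data.List using (List; []; _∷_; [_]; _++_; map)
open import Data.Nat.ListAction using (sum)
open import Data.Bool.ListAction using (any)
open import Data.Vec using ([]; _∷_)
open import Data.Vec.Properties using (≡-dec)
open import Data.Fin.Subset using (Subset; inside; outside; _⊆_; _─_; ∣_∣)
open import Data.Fin.Subset.Properties using (_⊆?_)
open import Data.Product using (_×_)
open import Relation.Nullary.Decidable using (⌊_⌋)
open import Relation.Binary.PropositionalEquality using (_≡_)

Family : ℕ → Set
Family N = Subset N → Bool

allSubsets : (N : ℕ) → List (Subset N)
allSubsets zero    = [ [] ]
allSubsets (suc N) = map (inside ∷_) (allSubsets N) ++ map (outside ∷_) (allSubsets N)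

card : {N : ℕ} → Family N → ℕ
card {N} A = sum (map (λ s → if A s then 1 else 0) (allSubsets N))

_≟ˢ_ : {N : ℕ} → (x y : Subset N) → Relation.Nullary.Decidable.Dec (x ≡ y)
_≟ˢ_ = ≡-dec B._≟_

-- A(X) = { F \ X : F ∈ A, X ⊆ F } : G ∈ A(X) iff some F ∈ A with X ⊆ F has G = F \ X.
link : {N : ℕ} → Family N → Subset N → Family N
link {N} A X G = any (λ F → A F ∧ ⌊ X ⊆? F ⌋ ∧ ⌊ G ≟ˢ (F ─ X) ⌋) (allSubsets N)

level : {N : ℕ} → Family N → ℕ → Family N
level C k s = C s ∧ ⌊ ∣ s ∣ ≟ k ⌋

IsSimplicialComplex : {N : ℕ} → Family N → Set
IsSimplicialComplex {N} C = (A B : Subset N) → B ⊆ A → T (C A) → T (C B)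

IsMaximal : {N : ℕ} → Family N → Subset N → Set
IsMaximal {N} C A = T (C A) × ((B : Subset N) → T (C B) → A ⊆ B → A ≡ B)

-- A is r-spread with r = p / q (q ≠ 0, p ≠ 0): |A(X)| ≤ r^{-|X|} |A| for every X,
-- written with denominators cleared:  |A(X)| * p^{|X|} ≤ q^{|X|} * |A|.
IsSpread : {N : ℕ} → ℕ → ℕ → Family N → Set
IsSpread {N} p q A = (X : Subset N) → card (link A X) * p ^ ∣ X ∣ ≤ q ^ ∣ X ∣ * card A

IsRQSpread : {N : ℕ} → ℕ → ℕ → ℕ → Family N → Set
IsRQSpread {N} p q Q A = (S : Subset N) → ∣ S ∣ ≤ Q → IsSpread p q (link A S)

-- Write L = C⁽ᵏ⁾. A member of the link of a link, L(S)(X), is a member of L(S ∪ X), and L(S)(X) is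
-- empty unless X and S are disjoint, so it suffices to show |L(W ∪ {x})| · n ≤ k · |L(W)| for x ∉ W
-- and to add the points of X one at a time. The sets of L(W) containing x contain all G ∪ {x} with
-- G ∈ L(W ∪ {x}); let A be the family of those avoiding x. For G ∈ L(W ∪ {x}) the face G ∪ W ∪ {x}
-- lies in a maximal face M with |M| ≥ n, and each of the at least n − k points y of M outside it
-- gives G ∪ {y} ∈ A; conversely every F ∈ A arises from at most |F| ≤ k such pairs (G , y). Double
-- counting the pairs gives |L(W ∪ {x})| · (n − k) ≤ k · |A|, hence |L(W ∪ {x})| · n ≤ k · |L(W)|.

module Submission where

open import Data.Bool using (Bool; true; false; T; not; _∧_; if_then_else_)
open import Data.Bool.Properties using (T-∧)
open import Data.Empty using (⊥-elim)
open import Data.Fin using (Fin; zero; suc; _≟_)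
open import Data.Fin.Properties using (any?)
open import Data.Fin.Subset
  using (Subset; inside; outside; _∈_; _∉_; _⊆_; _∪_; _∩_; _─_; _-_; ⁅_⁆; ⊥; ∣_∣; Nonempty)
open import Data.Fin.Subset.Properties
  using ( _∈?_; _⊆?_; nonempty?; drop-there; ⊆-trans; ⊆-antisym; ∣p∣≤n; x∈⁅x⁆; x∈⁅y⁆⇒x≡y
        ; ∪-identityʳ; ∪-assoc; ∪-comm; p⊆p∪q; q⊆p∪q; x∈p∪q⁻; x∈p∪q⁺; ∣p∣≤∣p∪q∣; x∈p∩q⁻; x∈p∩q⁺
        ; p─q⊆p; x∈p∧x∉q⇒x∈p─q; x∈p∧x≢y⇒x∈p-y)
open import Data.List using (map; _++_)
open import Data.List.Properties using (map-++; map-∘)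
import Data.List.Membership.Propositional as List
open import Data.List.Membership.Propositional using (lose)
open import Data.List.Membership.Propositional.Properties using (∈-map⁺; ∈-++⁺ˡ; ∈-++⁺ʳ)
import Data.List.Relation.Unary.Any as Any
open import Data.List.Relation.Unary.Any.Properties using (any⁺; any⁻)
open import Data.Nat as ℕ using (ℕ; zero; suc; _+_; _*_; _∸_; _^_; _≤_; z≤n; s≤s)
open import Data.Nat.ListAction using (sum)
open import Data.Nat.ListAction.Properties using (sum-++)
open import Data.Nat.Properties hiding (_≟_)
open import Data.Product using (Σ-syntax; _×_; _,_; proj₁; proj₂)
open import Data.Sum using (_⊎_; inj₁; inj₂; [_,_])
open import Data.Vec using ([]; _∷_; here; there; lookup)
open import Function using (_∘_; id)
open import Function.Bundles using (module Equivalence)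
open import Relation.Binary.PropositionalEquality
  using (_≡_; refl; sym; trans; cong; cong₂; subst; module ≡-Reasoning)
open import Relation.Nullary using (yes; no; ¬_; contradiction)
open import Relation.Nullary.Decidable using (toWitness; fromWitness; ¬?; _×-dec_; T?)

open import Algebra.Properties.CommutativeSemigroup +-commutativeSemigroup
  using () renaming (interchange to +-interchange)
open import Algebra.Properties.Semiring.Sum +-*-semiring using (sum-syntax; *-distribʳ-sum)
open import Defs
open Equivalence using (to; from)

private variable
  N : ℕ
  b : Bool
  i x y : Fin N
  p q r : Subset N
  C : Family N

-- Sums over all subsets of Fin N

𝟙 : Bool → ℕ
𝟙 b = if b then 1 else 0

∑ˢ : (Subset N → ℕ) → ℕ
∑ˢ {zero}  f = f []
∑ˢ {suc N} f = ∑ˢ (f ∘ (inside ∷_)) + ∑ˢ (f ∘ (outside ∷_))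

sum-map-allSubsets : (f : Subset N → ℕ) → sum (map f (allSubsets N)) ≡ ∑ˢ f
sum-map-allSubsets {zero}  f = +-identityʳ (f [])
sum-map-allSubsets {suc N} f = begin
  sum (map f (map (inside ∷_) L ++ map (outside ∷_) L))
    ≡⟨ cong sum (map-++ f (map (inside ∷_) L) _) ⟩
  sum (map f (map (inside ∷_) L) ++ map f (map (outside ∷_) L))
    ≡⟨ sum-++ (map f (map (inside ∷_) L)) _ ⟩
  sum (map f (map (inside ∷_) L)) + sum (map f (map (outside ∷_) L))
    ≡⟨ cong₂ _+_ (cong sum (map-∘ L)) (cong sum (map-∘ L)) ⟨
  sum (map (f ∘ (inside ∷_)) L) + sum (map (f ∘ (outside ∷_)) L)
    ≡⟨ cong₂ _+_ (sum-map-allSubsets {N} _) (sum-map-allSubsets {N} _) ⟩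
  ∑ˢ f ∎
  where
  open ≡-Reasoning
  L = allSubsets N

card≡∑ˢ : (A : Family N) → card A ≡ ∑ˢ (𝟙 ∘ A)
card≡∑ˢ A = sum-map-allSubsets (𝟙 ∘ A)

∑ˢ-cong : {f g : Subset N → ℕ} → (∀ s → f s ≡ g s) → ∑ˢ f ≡ ∑ˢ g
∑ˢ-cong {zero}  f≡g = f≡g []
∑ˢ-cong {suc N} f≡g = cong₂ _+_ (∑ˢ-cong (f≡g ∘ (inside ∷_))) (∑ˢ-cong (f≡g ∘ (outside ∷_)))

∑ˢ-mono-≤ : {f g : Subset N → ℕ} → (∀ s → f s ≤ g s) → ∑ˢ f ≤ ∑ˢ g
∑ˢ-mono-≤ {zero}  f≤g = f≤g []
∑ˢ-mono-≤ {suc N} f≤g = +-mono-≤ (∑ˢ-mono-≤ (f≤g ∘ (inside ∷_))) (∑ˢ-mono-≤ (f≤g ∘ (outside ∷_)))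

∑ˢ-zero : ∑ˢ {N} (λ _ → 0) ≡ 0
∑ˢ-zero {zero}  = refl
∑ˢ-zero {suc N} = cong₂ _+_ (∑ˢ-zero {N}) (∑ˢ-zero {N})

∑ˢ-distrib-+ : (f g : Subset N → ℕ) → ∑ˢ (λ s → f s + g s) ≡ ∑ˢ f + ∑ˢ g
∑ˢ-distrib-+ {zero}  f g = refl
∑ˢ-distrib-+ {suc N} f g =
  trans (cong₂ _+_ (∑ˢ-distrib-+ {N} _ _) (∑ˢ-distrib-+ {N} _ _))
        (+-interchange (∑ˢ (f ∘ (inside ∷_))) (∑ˢ (g ∘ (inside ∷_))) _ _)

*-distribˡ-∑ˢ : (c : ℕ) (f : Subset N → ℕ) → c * ∑ˢ f ≡ ∑ˢ (λ s → c * f s)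
*-distribˡ-∑ˢ {zero}  c f = refl
*-distribˡ-∑ˢ {suc N} c f =
  trans (*-distribˡ-+ c (∑ˢ (f ∘ (inside ∷_))) (∑ˢ (f ∘ (outside ∷_))))
        (cong₂ _+_ (*-distribˡ-∑ˢ {N} c _) (*-distribˡ-∑ˢ {N} c _))

∑ˢ-comm-∑ : {M : ℕ} (h : Fin M → Subset N → ℕ) → ∑ˢ (λ s → ∑[ y < M ] h y s) ≡ ∑[ y < M ] ∑ˢ (h y)
∑ˢ-comm-∑ {N} {zero}  h = ∑ˢ-zero {N}
∑ˢ-comm-∑ {N} {suc M} h =
  trans (∑ˢ-distrib-+ (h zero) _) (cong (∑ˢ (h zero) +_) (∑ˢ-comm-∑ (h ∘ suc)))

-- G ↦ G ∪ ⁅ y ⁆ is injective on the subsets avoiding y.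
∑ˢ-insert-≤ : (y : Fin N) (φ χ : Subset N → ℕ) →
  (∀ G → y ∈ G → φ G ≡ 0) → (∀ G → y ∉ G → φ G ≤ χ (G ∪ ⁅ y ⁆)) →
  ∑ˢ φ ≤ ∑ˢ (λ F → 𝟙 (lookup F y) * χ F)
∑ˢ-insert-≤ {suc N} zero φ χ φ-vanishes φ≤χ = begin
  ∑ˢ (φ ∘ (inside ∷_)) + ∑ˢ (φ ∘ (outside ∷_))   ≡⟨ cong (_+ ∑ˢ (φ ∘ (outside ∷_))) vanishing-half ⟩
  ∑ˢ (φ ∘ (outside ∷_))                          ≤⟨ ∑ˢ-mono-≤ bound ⟩
  ∑ˢ (λ G → 1 * χ (inside ∷ G))                  ≤⟨ m≤m+n _ _ ⟩
  ∑ˢ (λ G → 1 * χ (inside ∷ G)) + ∑ˢ (λ G → 0 * χ (outside ∷ G)) ∎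
  where
  open ≤-Reasoning
  vanishing-half : ∑ˢ (φ ∘ (inside ∷_)) ≡ 0
  vanishing-half = trans (∑ˢ-cong (λ G → φ-vanishes (inside ∷ G) here)) (∑ˢ-zero {N})
  bound : ∀ G → φ (outside ∷ G) ≤ 1 * χ (inside ∷ G)
  bound G = ≤-trans (φ≤χ (outside ∷ G) λ ())
    (≤-reflexive (trans (cong (χ ∘ (inside ∷_)) (∪-identityʳ G)) (sym (*-identityˡ _))))
∑ˢ-insert-≤ {suc N} (suc y) φ χ φ-vanishes φ≤χ = +-mono-≤
  (∑ˢ-insert-≤ y (φ ∘ (inside ∷_)) (χ ∘ (inside ∷_))
    (λ G y∈G → φ-vanishes _ (there y∈G)) (λ G y∉G → φ≤χ _ (y∉G ∘ drop-there)))
  (∑ˢ-insert-≤ y (φ ∘ (outside ∷_)) (χ ∘ (outside ∷_))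
    (λ G y∈G → φ-vanishes _ (there y∈G)) (λ G y∉G → φ≤χ _ (y∉G ∘ drop-there)))

𝟙-mono-≤ : {a b : Bool} → (T a → T b) → 𝟙 a ≤ 𝟙 b
𝟙-mono-≤ {false}         _   = z≤n
𝟙-mono-≤ {true}  {true}  _   = ≤-refl
𝟙-mono-≤ {true}  {false} a⇒b = ⊥-elim (a⇒b _)

𝟙*-≤ : {m n : ℕ} → (T b → m ≤ n) → 𝟙 b * m ≤ n
𝟙*-≤ {false} _   = z≤n
𝟙*-≤ {true}  m≤n = ≤-trans (≤-reflexive (*-identityˡ _)) (m≤n _)

*𝟙-monoˡ-≤ : {m n : ℕ} → (T b → m ≤ n) → m * 𝟙 b ≤ n * 𝟙 b
*𝟙-monoˡ-≤ {false} {m} {n} _ = ≤-reflexive (trans (*-zeroʳ m) (sym (*-zeroʳ n)))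
*𝟙-monoˡ-≤ {true}          m≤n = *-monoˡ-≤ 1 (m≤n _)

𝟙-split : (a b : Bool) → 𝟙 b ≡ 𝟙 a * 𝟙 b + 𝟙 (b ∧ not a)
𝟙-split false false = refl
𝟙-split false true  = refl
𝟙-split true  false = refl
𝟙-split true  true  = refl

card-mono-≤ : {A B : Family N} → (∀ s → T (A s) → T (B s)) → card A ≤ card B
card-mono-≤ {A = A} {B} A⊆B = begin
  card A         ≡⟨ card≡∑ˢ A ⟩
  ∑ˢ (𝟙 ∘ A)     ≤⟨ ∑ˢ-mono-≤ (λ s → 𝟙-mono-≤ (A⊆B s)) ⟩
  ∑ˢ (𝟙 ∘ B)     ≡⟨ card≡∑ˢ B ⟨
  card B ∎
  where open ≤-Reasoning

¬T⇒𝟙≡0 : ¬ T b → 𝟙 b ≡ 0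
¬T⇒𝟙≡0 {false} _  = refl
¬T⇒𝟙≡0 {true}  ¬t = contradiction _ ¬t

card-empty : (A : Family N) → (∀ s → ¬ T (A s)) → card A ≡ 0
card-empty {N} A A-empty = trans (card≡∑ˢ A) (trans (∑ˢ-cong (¬T⇒𝟙≡0 ∘ A-empty)) (∑ˢ-zero {N}))

∑-mono-≤ : {M : ℕ} {f g : Fin M → ℕ} → (∀ i → f i ≤ g i) → ∑[ i < M ] f i ≤ ∑[ i < M ] g i
∑-mono-≤ {zero}  f≤g = z≤n
∑-mono-≤ {suc M} f≤g = +-mono-≤ (f≤g zero) (∑-mono-≤ (f≤g ∘ suc))

∈⇒¬T-not-lookup : i ∈ p → ¬ T (not (lookup p i))
∈⇒¬T-not-lookup here        ()
∈⇒¬T-not-lookup (there i∈p) = ∈⇒¬T-not-lookup i∈p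

T-lookup⇒∈ : (p : Subset N) (i : Fin N) → T (lookup p i) → i ∈ p
T-lookup⇒∈ (true ∷ p) zero    _ = here
T-lookup⇒∈ (_ ∷ p)    (suc i) t = there (T-lookup⇒∈ p i t)

∣p∣≡∑𝟙 : (p : Subset N) → ∣ p ∣ ≡ ∑[ i < N ] 𝟙 (lookup p i)
∣p∣≡∑𝟙 []          = refl
∣p∣≡∑𝟙 (true ∷ p)  = cong suc (∣p∣≡∑𝟙 p)
∣p∣≡∑𝟙 (false ∷ p) = ∣p∣≡∑𝟙 p

∣p∣≤∑𝟙 : (p : Subset N) (P : Fin N → Bool) → (∀ {i} → i ∈ p → T (P i)) →
  ∣ p ∣ ≤ ∑[ i < N ] 𝟙 (P i)
∣p∣≤∑𝟙 p P p⊆P =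
  ≤-trans (≤-reflexive (∣p∣≡∑𝟙 p)) (∑-mono-≤ λ i → 𝟙-mono-≤ (p⊆P ∘ T-lookup⇒∈ p i))

x∈p─q⇒x∉q : (p q : Subset N) → x ∈ p ─ q → x ∉ q
x∈p─q⇒x∉q (s ∷ p) (outside ∷ q) here        ()
x∈p─q⇒x∉q (s ∷ p) (t ∷ q)       (there x∈) (there x∈q) = x∈p─q⇒x∉q p q x∈ x∈q

∣p∣≤∣q∣+∣p─q∣ : (p q : Subset N) → ∣ p ∣ ≤ ∣ q ∣ + ∣ p ─ q ∣
∣p∣≤∣q∣+∣p─q∣ []          []          = z≤n
∣p∣≤∣q∣+∣p─q∣ (true ∷ p)  (true ∷ q)  = s≤s (∣p∣≤∣q∣+∣p─q∣ p q)
∣p∣≤∣q∣+∣p─q∣ (true ∷ p)  (false ∷ q) = ≤-trans (s≤s (∣p∣≤∣q∣+∣p─q∣ p q)) (≤-reflexive (sym (+-suc ∣ q ∣ _)))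
∣p∣≤∣q∣+∣p─q∣ (false ∷ p) (true ∷ q)  = m≤n⇒m≤1+n (∣p∣≤∣q∣+∣p─q∣ p q)
∣p∣≤∣q∣+∣p─q∣ (false ∷ p) (false ∷ q) = ∣p∣≤∣q∣+∣p─q∣ p q

x∉p⇒∣p∪⁅x⁆∣≡1+∣p∣ : (p : Subset N) → x ∉ p → ∣ p ∪ ⁅ x ⁆ ∣ ≡ suc ∣ p ∣
x∉p⇒∣p∪⁅x⁆∣≡1+∣p∣ {x = zero}  (true ∷ p)  x∉p = contradiction here x∉p
x∉p⇒∣p∪⁅x⁆∣≡1+∣p∣ {x = zero}  (false ∷ p) _   = cong (suc ∘ ∣_∣) (∪-identityʳ p)
x∉p⇒∣p∪⁅x⁆∣≡1+∣p∣ {x = suc x} (true ∷ p)  x∉p = cong suc (x∉p⇒∣p∪⁅x⁆∣≡1+∣p∣ p (x∉p ∘ there))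
x∉p⇒∣p∪⁅x⁆∣≡1+∣p∣ {x = suc x} (false ∷ p) x∉p = x∉p⇒∣p∪⁅x⁆∣≡1+∣p∣ p (x∉p ∘ there)

∣p∣≡0⇒p≡⊥ : (p : Subset N) → ∣ p ∣ ≡ 0 → p ≡ ⊥
∣p∣≡0⇒p≡⊥ []          _ = refl
∣p∣≡0⇒p≡⊥ (false ∷ p) e = cong (outside ∷_) (∣p∣≡0⇒p≡⊥ p e)

∣p∣≡1+d⇒nonempty : {d : ℕ} (p : Subset N) → ∣ p ∣ ≡ suc d → Nonempty p
∣p∣≡1+d⇒nonempty (true ∷ p)  _ = zero , here
∣p∣≡1+d⇒nonempty (false ∷ p) e with i , i∈p ← ∣p∣≡1+d⇒nonempty p e = suc i , there i∈p

∪-least : p ⊆ r → q ⊆ r → p ∪ q ⊆ r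
∪-least {p = p} {q = q} p⊆r q⊆r = [ p⊆r , q⊆r ] ∘ x∈p∪q⁻ p q

x∈p⇒⁅x⁆⊆p : x ∈ p → ⁅ x ⁆ ⊆ p
x∈p⇒⁅x⁆⊆p {x = x} {p = p} x∈p y∈⁅x⁆ = subst (_∈ p) (sym (x∈⁅y⁆⇒x≡y x y∈⁅x⁆)) x∈p

[p∪q]∪r≡p∪[r∪q] : (p q r : Subset N) → (p ∪ q) ∪ r ≡ p ∪ (r ∪ q)
[p∪q]∪r≡p∪[r∪q] p q r = trans (∪-assoc p q r) (cong (p ∪_) (∪-comm q r))

x∈p⇒[p-x]∪⁅x⁆≡p : (p : Subset N) → x ∈ p → (p - x) ∪ ⁅ x ⁆ ≡ p
x∈p⇒[p-x]∪⁅x⁆≡p {x = x} p x∈p = ⊆-antisym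
  (∪-least (p─q⊆p p ⁅ x ⁆) (x∈p⇒⁅x⁆⊆p x∈p))
  λ {i} i∈p → x∈p∪q⁺ (split i i∈p)
  where
  split : ∀ i → i ∈ p → i ∈ p - x ⊎ i ∈ ⁅ x ⁆
  split i i∈p with i ≟ x
  ... | yes refl = inj₂ (x∈⁅x⁆ x)
  ... | no  i≢x  = inj₁ (x∈p∧x≢y⇒x∈p-y i∈p i≢x)

x∉p-x : (p : Subset N) → x ∉ p - x
x∉p-x {x = x} p x∈p-x = x∈p─q⇒x∉q p ⁅ x ⁆ x∈p-x (x∈⁅x⁆ x)

∉⇒T-not-lookup : (p : Subset N) (i : Fin N) → i ∉ p → T (not (lookup p i))
∉⇒T-not-lookup p i i∉p with lookup p i in eq
... | true  = contradiction (T-lookup⇒∈ p i (subst T (sym eq) _)) i∉p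
... | false = _

∣[p∪⁅y⁆]∪q∣≡∣p∪[q∪⁅x⁆]∣ : (p q : Subset N) → y ∉ p ∪ q → x ∉ p ∪ q →
  ∣ (p ∪ ⁅ y ⁆) ∪ q ∣ ≡ ∣ p ∪ (q ∪ ⁅ x ⁆) ∣
∣[p∪⁅y⁆]∪q∣≡∣p∪[q∪⁅x⁆]∣ {y = y} {x = x} p q y∉ x∉ = begin
  ∣ (p ∪ ⁅ y ⁆) ∪ q ∣ ≡⟨ cong ∣_∣ ([p∪q]∪r≡p∪[r∪q] p ⁅ y ⁆ q) ⟩
  ∣ p ∪ (q ∪ ⁅ y ⁆) ∣ ≡⟨ cong ∣_∣ (∪-assoc p q ⁅ y ⁆) ⟨
  ∣ (p ∪ q) ∪ ⁅ y ⁆ ∣ ≡⟨ x∉p⇒∣p∪⁅x⁆∣≡1+∣p∣ (p ∪ q) y∉ ⟩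
  suc ∣ p ∪ q ∣       ≡⟨ x∉p⇒∣p∪⁅x⁆∣≡1+∣p∣ (p ∪ q) x∉ ⟨
  ∣ (p ∪ q) ∪ ⁅ x ⁆ ∣ ≡⟨ cong ∣_∣ (∪-assoc p q ⁅ x ⁆) ⟩
  ∣ p ∪ (q ∪ ⁅ x ⁆) ∣ ∎
  where open ≡-Reasoning

Disjoint : Subset N → Subset N → Set
Disjoint p q = ∀ {i} → i ∈ p → i ∉ q

x∉p⇒Disjoint⁅x⁆p : x ∉ p → Disjoint ⁅ x ⁆ p
x∉p⇒Disjoint⁅x⁆p {x = x} {p = p} x∉p i∈⁅x⁆ i∈p = x∉p (subst (_∈ p) (x∈⁅y⁆⇒x≡y x i∈⁅x⁆) i∈p)

q⊆p⇒[p─q]∪q≡p : (p q : Subset N) → q ⊆ p → (p ─ q) ∪ q ≡ p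
q⊆p⇒[p─q]∪q≡p p q q⊆p = ⊆-antisym (∪-least (p─q⊆p p q) q⊆p) λ {i} i∈p → x∈p∪q⁺ (split i i∈p)
  where
  split : ∀ i → i ∈ p → i ∈ p ─ q ⊎ i ∈ q
  split i i∈p with i ∈? q
  ... | yes i∈q = inj₂ i∈q
  ... | no  i∉q = inj₁ (x∈p∧x∉q⇒x∈p─q i∈p i∉q)

disjoint⇒[p∪q]─q≡p : (p q : Subset N) → Disjoint p q → (p ∪ q) ─ q ≡ p
disjoint⇒[p∪q]─q≡p p q p∩q≡∅ = ⊆-antisym
  (λ i∈ → [ id , (λ i∈q → contradiction i∈q (x∈p─q⇒x∉q (p ∪ q) q i∈)) ]
            (x∈p∪q⁻ p q (p─q⊆p (p ∪ q) q i∈)))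
  (λ i∈p → x∈p∧x∉q⇒x∈p─q (p⊆p∪q q i∈p) (p∩q≡∅ i∈p))

-- Links

∈-allSubsets : (s : Subset N) → s List.∈ allSubsets N
∈-allSubsets []          = Any.here refl
∈-allSubsets (true ∷ s)  = ∈-++⁺ˡ (∈-map⁺ (inside ∷_) (∈-allSubsets s))
∈-allSubsets (false ∷ s) = ∈-++⁺ʳ _ (∈-map⁺ (outside ∷_) (∈-allSubsets s))

link⁻ : (A : Family N) (X G : Subset N) → T (link A X G) → Disjoint G X × T (A (G ∪ X))
link⁻ {N} A X G G∈
  with F , F-ok ← Any.satisfied (any⁻ _ (allSubsets N) G∈)
  with A∋F , F-ok′ ← to T-∧ F-ok
  with X⊆F? , G≡F─X? ← to T-∧ F-ok′
  with refl ← toWitness {a? = G ≟ˢ (F ─ X)} G≡F─X? =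
  (λ i∈F─X → x∈p─q⇒x∉q F X i∈F─X) ,
  subst (T ∘ A) (sym (q⊆p⇒[p─q]∪q≡p F X (toWitness {a? = X ⊆? F} X⊆F?))) A∋F

link⁺ : (A : Family N) (X G : Subset N) → Disjoint G X → T (A (G ∪ X)) → T (link A X G)
link⁺ A X G G∩X≡∅ A∋G∪X = any⁺ _ (lose (∈-allSubsets (G ∪ X))
  (from T-∧ (A∋G∪X , from T-∧ (fromWitness {a? = X ⊆? (G ∪ X)} (q⊆p∪q G X) ,
                              fromWitness {a? = G ≟ˢ ((G ∪ X) ─ X)} (sym (disjoint⇒[p∪q]─q≡p G X G∩X≡∅))))))

level⁻ : (C : Family N) (k : ℕ) (s : Subset N) → T (level C k s) → T (C s) × ∣ s ∣ ≡ k
level⁻ C k s s∈ with C∋s , size? ← to T-∧ s∈ = C∋s , toWitness {a? = ∣ s ∣ ℕ.≟ k} size?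

level⁺ : (C : Family N) (k : ℕ) (s : Subset N) → T (C s) → ∣ s ∣ ≡ k → T (level C k s)
level⁺ C k s C∋s refl = from T-∧ (C∋s , fromWitness {a? = ∣ s ∣ ℕ.≟ k} refl)

link-∪⇒link : (A : Family N) (W Y G : Subset N) → Disjoint Y W →
  T (link A (W ∪ Y) G) → T (link A W (G ∪ Y))
link-∪⇒link A W Y G Y∩W≡∅ G∈ with G∩W∪Y≡∅ , A∋ ← link⁻ A (W ∪ Y) G G∈ =
  link⁺ A W (G ∪ Y) G∪Y∩W≡∅ (subst (T ∘ A) (sym ([p∪q]∪r≡p∪[r∪q] G Y W)) A∋)
  where
  G∪Y∩W≡∅ : Disjoint (G ∪ Y) W
  G∪Y∩W≡∅ i∈G∪Y = [ (λ i∈G i∈W → G∩W∪Y≡∅ i∈G (p⊆p∪q Y i∈W)) , Y∩W≡∅ ] (x∈p∪q⁻ G Y i∈G∪Y)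

link-link⇒link-∪ : (A : Family N) (S X G : Subset N) → T (link (link A S) X G) → T (link A (S ∪ X) G)
link-link⇒link-∪ A S X G G∈
  with G∩X≡∅ , G∪X∈ ← link⁻ (link A S) X G G∈
  with G∪X∩S≡∅ , A∋ ← link⁻ A S (G ∪ X) G∪X∈ =
  link⁺ A (S ∪ X) G G∩S∪X≡∅ (subst (T ∘ A) ([p∪q]∪r≡p∪[r∪q] G X S) A∋)
  where
  G∩S∪X≡∅ : Disjoint G (S ∪ X)
  G∩S∪X≡∅ i∈G = [ G∪X∩S≡∅ (p⊆p∪q X i∈G) , G∩X≡∅ i∈G ] ∘ x∈p∪q⁻ S X

link-link-empty : (A : Family N) (S X G : Subset N) → Nonempty (X ∩ S) → ¬ T (link (link A S) X G)
link-link-empty A S X G (_ , i∈X∩S) G∈ with _ , G∪X∈ ← link⁻ (link A S) X G G∈ =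
  proj₁ (link⁻ A S (G ∪ X) G∪X∈) (q⊆p∪q G X (proj₁ (x∈p∩q⁻ X S i∈X∩S))) (proj₂ (x∈p∩q⁻ X S i∈X∩S))

-- Maximal faces

unextendable⇒maximal : IsSimplicialComplex C → (Z : Subset N) → T (C Z) →
  (∀ y → y ∉ Z → ¬ T (C (Z ∪ ⁅ y ⁆))) → IsMaximal C Z
unextendable⇒maximal {C = C} closed Z C∋Z stuck = C∋Z , λ B C∋B Z⊆B → ⊆-antisym Z⊆B (B⊆Z B C∋B Z⊆B)
  where
  B⊆Z : ∀ B → T (C B) → Z ⊆ B → B ⊆ Z
  B⊆Z B C∋B Z⊆B {i} i∈B with i ∈? Z
  ... | yes i∈Z = i∈Z
  ... | no  i∉Z = contradiction (closed B (Z ∪ ⁅ i ⁆) (∪-least Z⊆B (x∈p⇒⁅x⁆⊆p i∈B)) C∋B) (stuck i i∉Z)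

maximal-extension : IsSimplicialComplex C → (slack : ℕ) (Z : Subset N) → N ≤ slack + ∣ Z ∣ → T (C Z) →
  Σ[ M ∈ Subset N ] (Z ⊆ M × IsMaximal C M)
maximal-extension {C = C} closed slack Z N≤ C∋Z
  with any? (λ y → ¬? (y ∈? Z) ×-dec T? (C (Z ∪ ⁅ y ⁆)))
... | no stuck = Z , id , unextendable⇒maximal closed Z C∋Z (λ y y∉Z C∋Z∪y → stuck (y , y∉Z , C∋Z∪y))
maximal-extension closed zero Z N≤∣Z∣ _ | yes (y , y∉Z , _) =
  contradiction (≤-trans (subst (_≤ _) (x∉p⇒∣p∪⁅x⁆∣≡1+∣p∣ Z y∉Z) (∣p∣≤n (Z ∪ ⁅ y ⁆))) N≤∣Z∣)
                (n≮n ∣ Z ∣)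
maximal-extension {N} closed (suc slack) Z N≤ _ | yes (y , y∉Z , C∋Z∪y)
  with M , Z∪y⊆M , M-maximal ← maximal-extension closed slack (Z ∪ ⁅ y ⁆)
         (subst (N ≤_) (trans (sym (+-suc slack ∣ Z ∣))
                              (cong (slack +_) (sym (x∉p⇒∣p∪⁅x⁆∣≡1+∣p∣ Z y∉Z)))) N≤)
         C∋Z∪y
  = M , ⊆-trans (p⊆p∪q ⁅ y ⁆) Z∪y⊆M , M-maximal

-- Exchanging points

module _ (C : Family N) (k : ℕ) where

  link-level⁻ : (W G : Subset N) → T (link (level C k) W G) →
    Disjoint G W × T (C (G ∪ W)) × ∣ G ∪ W ∣ ≡ k
  link-level⁻ W G G∈ with G∩W≡∅ , G∪W∈ ← link⁻ (level C k) W G G∈ = G∩W≡∅ , level⁻ C k (G ∪ W) G∪W∈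

  link-level⁺ : (W G : Subset N) → Disjoint G W → T (C (G ∪ W)) → ∣ G ∪ W ∣ ≡ k →
    T (link (level C k) W G)
  link-level⁺ W G G∩W≡∅ C∋ size = link⁺ (level C k) W G G∩W≡∅ (level⁺ C k (G ∪ W) C∋ size)

  link-exchange : (W G : Subset N) → x ∉ W → T (link (level C k) (W ∪ ⁅ x ⁆) G) →
    y ∉ G ∪ (W ∪ ⁅ x ⁆) → T (C ((G ∪ ⁅ y ⁆) ∪ W)) →
    T (link (level C k) W (G ∪ ⁅ y ⁆) ∧ not (lookup (G ∪ ⁅ y ⁆) x))
  link-exchange {x = x} {y = y} W G x∉W G∈ y∉G∪W′ C∋
    with G∩W′≡∅ , _ , size ← link-level⁻ (W ∪ ⁅ x ⁆) G G∈ =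
    from T-∧ ( link-level⁺ W (G ∪ ⁅ y ⁆) G∪y∩W≡∅ C∋
                 (trans (∣[p∪⁅y⁆]∪q∣≡∣p∪[q∪⁅x⁆]∣ G W y∉G∪W x∉G∪W) size)
             , ∉⇒T-not-lookup (G ∪ ⁅ y ⁆) x ([ x∉G , x∉⁅y⁆ ] ∘ x∈p∪q⁻ G ⁅ y ⁆))
    where
    x∉G : x ∉ G
    x∉G x∈G = G∩W′≡∅ x∈G (q⊆p∪q W ⁅ x ⁆ (x∈⁅x⁆ x))
    y∉G : y ∉ G
    y∉G = y∉G∪W′ ∘ p⊆p∪q (W ∪ ⁅ x ⁆)
    y∉W : y ∉ W
    y∉W = y∉G∪W′ ∘ q⊆p∪q G (W ∪ ⁅ x ⁆) ∘ p⊆p∪q ⁅ x ⁆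
    x∉⁅y⁆ : x ∉ ⁅ y ⁆
    x∉⁅y⁆ x∈⁅y⁆ = x∉p⇒Disjoint⁅x⁆p y∉G∪W′ x∈⁅y⁆ (q⊆p∪q G _ (q⊆p∪q W ⁅ x ⁆ (x∈⁅x⁆ x)))
    y∉G∪W : y ∉ G ∪ W
    y∉G∪W = [ y∉G , y∉W ] ∘ x∈p∪q⁻ G W
    x∉G∪W : x ∉ G ∪ W
    x∉G∪W = [ x∉G , x∉W ] ∘ x∈p∪q⁻ G W
    G∪y∩W≡∅ : Disjoint (G ∪ ⁅ y ⁆) W
    G∪y∩W≡∅ i∈G∪y i∈W = [ (λ i∈G → G∩W′≡∅ i∈G (p⊆p∪q ⁅ x ⁆ i∈W))
                         , (λ i∈⁅y⁆ → x∉p⇒Disjoint⁅x⁆p y∉W i∈⁅y⁆ i∈W) ] (x∈p∪q⁻ G ⁅ y ⁆ i∈G∪y)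

-- Double counting

module _ {C : Family N} (closed : IsSimplicialComplex C) {n k : ℕ}
         (large : (A : Subset N) → IsMaximal C A → n ≤ ∣ A ∣) where

  module _ (W : Subset N) {x : Fin N} (x∉W : x ∉ W) where

    avoiding : Family N
    avoiding F = link (level C k) W F ∧ not (lookup F x)

    card-containing : ℕ
    card-containing = ∑ˢ (λ F → 𝟙 (lookup F x) * 𝟙 (link (level C k) W F))

    exchanges : Fin N → Subset N → ℕ
    exchanges y G = 𝟙 (not (lookup G y) ∧ avoiding (G ∪ ⁅ y ⁆))

    exchange : (G : Subset N) → T (link (level C k) (W ∪ ⁅ x ⁆) G) →
      (M : Subset N) → G ∪ (W ∪ ⁅ x ⁆) ⊆ M → T (C M) →
      ∀ {y} → y ∈ M ─ (G ∪ (W ∪ ⁅ x ⁆)) → T (not (lookup G y) ∧ avoiding (G ∪ ⁅ y ⁆))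
    exchange G G∈ M Z⊆M C∋M {y} y∈M─Z = from T-∧
      ( ∉⇒T-not-lookup G y (y∉Z ∘ p⊆p∪q (W ∪ ⁅ x ⁆))
      , link-exchange C k W G x∉W G∈ y∉Z (closed M _ G∪y∪W⊆M C∋M))
      where
      y∉Z = x∈p─q⇒x∉q M _ y∈M─Z
      G∪y∪W⊆M : (G ∪ ⁅ y ⁆) ∪ W ⊆ M
      G∪y∪W⊆M = ∪-least (∪-least (Z⊆M ∘ p⊆p∪q _) (x∈p⇒⁅x⁆⊆p (p─q⊆p M _ y∈M─Z)))
                        (Z⊆M ∘ q⊆p∪q G _ ∘ p⊆p∪q ⁅ x ⁆)

    n∸k≤∑exchanges : (G : Subset N) → T (link (level C k) (W ∪ ⁅ x ⁆) G) → n ∸ k ≤ ∑[ y < N ] exchanges y G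
    n∸k≤∑exchanges G G∈
      with _ , C∋Z , ∣Z∣≡k ← link-level⁻ C k (W ∪ ⁅ x ⁆) G G∈
      with M , Z⊆M , M-maximal ← maximal-extension closed N _ (m≤m+n N _) C∋Z = begin
      n ∸ k                     ≤⟨ ∸-monoˡ-≤ k (large M M-maximal) ⟩
      ∣ M ∣ ∸ k                 ≡⟨ cong (∣ M ∣ ∸_) ∣Z∣≡k ⟨
      ∣ M ∣ ∸ ∣ Z ∣             ≤⟨ m≤n+o⇒m∸n≤o ∣ M ∣ ∣ Z ∣ (∣p∣≤∣q∣+∣p─q∣ M Z) ⟩
      ∣ M ─ Z ∣                 ≤⟨ ∣p∣≤∑𝟙 (M ─ Z) _ (exchange G G∈ M Z⊆M (proj₁ M-maximal)) ⟩
      ∑[ y < N ] exchanges y G  ∎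
      where
      open ≤-Reasoning
      Z = G ∪ (W ∪ ⁅ x ⁆)

    card-link-∪⁅x⁆≤card-containing : card (link (level C k) (W ∪ ⁅ x ⁆)) ≤ card-containing
    card-link-∪⁅x⁆≤card-containing = ≤-trans (≤-reflexive (card≡∑ˢ (link (level C k) (W ∪ ⁅ x ⁆))))
      (∑ˢ-insert-≤ x _ _
        (λ G x∈G → ¬T⇒𝟙≡0 λ G∈ →
          proj₁ (link⁻ (level C k) (W ∪ ⁅ x ⁆) G G∈) x∈G (q⊆p∪q W ⁅ x ⁆ (x∈⁅x⁆ x)))
        (λ G _ → 𝟙-mono-≤ (link-∪⇒link (level C k) W ⁅ x ⁆ G (x∉p⇒Disjoint⁅x⁆p x∉W))))

    card-link≡card-containing+card-avoiding : card (link (level C k) W) ≡ card-containing + card avoiding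
    card-link≡card-containing+card-avoiding = begin
      card (link (level C k) W)
        ≡⟨ card≡∑ˢ (link (level C k) W) ⟩
      ∑ˢ (λ F → 𝟙 (link (level C k) W F))
        ≡⟨ ∑ˢ-cong (λ F → 𝟙-split (lookup F x) (link (level C k) W F)) ⟩
      ∑ˢ (λ F → 𝟙 (lookup F x) * 𝟙 (link (level C k) W F) + 𝟙 (avoiding F))
        ≡⟨ ∑ˢ-distrib-+ {N} _ (𝟙 ∘ avoiding) ⟩
      card-containing + ∑ˢ (𝟙 ∘ avoiding)
        ≡⟨ cong (card-containing +_) (card≡∑ˢ avoiding) ⟨
      card-containing + card avoiding ∎
      where open ≡-Reasoning

    card-link-∪⁅x⁆*[n∸k]≤k*card-avoiding : card (link (level C k) (W ∪ ⁅ x ⁆)) * (n ∸ k) ≤ k * card avoiding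
    card-link-∪⁅x⁆*[n∸k]≤k*card-avoiding = begin
      card L′ * (n ∸ k)                                      ≡⟨ cong (_* (n ∸ k)) (card≡∑ˢ L′) ⟩
      ∑ˢ (𝟙 ∘ L′) * (n ∸ k)                                  ≡⟨ *-comm (∑ˢ (𝟙 ∘ L′)) (n ∸ k) ⟩
      (n ∸ k) * ∑ˢ (𝟙 ∘ L′)                                  ≡⟨ *-distribˡ-∑ˢ (n ∸ k) (𝟙 ∘ L′) ⟩
      ∑ˢ (λ G → (n ∸ k) * 𝟙 (L′ G))                          ≤⟨ ∑ˢ-mono-≤ {N} exchanges-from-G ⟩
      ∑ˢ (λ G → ∑[ y < N ] exchanges y G)                    ≡⟨ ∑ˢ-comm-∑ exchanges ⟩
      ∑[ y < N ] ∑ˢ (exchanges y)                            ≤⟨ ∑-mono-≤ exchanges-into-avoiding ⟩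
      ∑[ y < N ] ∑ˢ (λ F → 𝟙 (lookup F y) * 𝟙 (avoiding F))  ≡⟨ ∑ˢ-comm-∑ (λ y F → 𝟙 (lookup F y) * 𝟙 (avoiding F)) ⟨
      ∑ˢ (λ F → ∑[ y < N ] (𝟙 (lookup F y) * 𝟙 (avoiding F))) ≡⟨ ∑ˢ-cong {N} ∑-exchanges-into-F ⟩
      ∑ˢ (λ F → ∣ F ∣ * 𝟙 (avoiding F))                      ≤⟨ ∑ˢ-mono-≤ {N} (λ F → *𝟙-monoˡ-≤ (∣F∣≤k F)) ⟩
      ∑ˢ (λ F → k * 𝟙 (avoiding F))                          ≡⟨ *-distribˡ-∑ˢ k (𝟙 ∘ avoiding) ⟨
      k * ∑ˢ (𝟙 ∘ avoiding)                                  ≡⟨ cong (k *_) (card≡∑ˢ avoiding) ⟨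
      k * card avoiding                                      ∎
      where
      open ≤-Reasoning
      L′ = link (level C k) (W ∪ ⁅ x ⁆)
      exchanges-from-G : ∀ G → (n ∸ k) * 𝟙 (L′ G) ≤ ∑[ y < N ] exchanges y G
      exchanges-from-G G = ≤-trans (≤-reflexive (*-comm (n ∸ k) _)) (𝟙*-≤ (n∸k≤∑exchanges G))
      exchanges-into-avoiding : ∀ y → ∑ˢ (exchanges y) ≤ ∑ˢ (λ F → 𝟙 (lookup F y) * 𝟙 (avoiding F))
      exchanges-into-avoiding y = ∑ˢ-insert-≤ y (exchanges y) (𝟙 ∘ avoiding)
        (λ G y∈G → ¬T⇒𝟙≡0 (∈⇒¬T-not-lookup y∈G ∘ proj₁ ∘ to T-∧))
        (λ G _ → 𝟙-mono-≤ (proj₂ ∘ to (T-∧ {not (lookup G y)})))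
      ∑-exchanges-into-F : ∀ F → ∑[ y < N ] (𝟙 (lookup F y) * 𝟙 (avoiding F)) ≡ ∣ F ∣ * 𝟙 (avoiding F)
      ∑-exchanges-into-F F = sym (trans (cong (_* 𝟙 (avoiding F)) (∣p∣≡∑𝟙 F))
                                        (*-distribʳ-sum (𝟙 (avoiding F)) (λ y → 𝟙 (lookup F y))))
      ∣F∣≤k : ∀ F → T (avoiding F) → ∣ F ∣ ≤ k
      ∣F∣≤k F F∈ = ≤-trans (∣p∣≤∣p∪q∣ F W)
        (≤-reflexive (proj₂ (proj₂ (link-level⁻ C k W F (proj₁ (to T-∧ F∈))))))

    card-link-∪⁅x⁆*n≤k*card-link : card (link (level C k) (W ∪ ⁅ x ⁆)) * n ≤ k * card (link (level C k) W)
    card-link-∪⁅x⁆*n≤k*card-link = begin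
      a * n                                         ≤⟨ *-monoʳ-≤ a (m≤n+m∸n n k) ⟩
      a * (k + (n ∸ k))                             ≡⟨ *-distribˡ-+ a k (n ∸ k) ⟩
      a * k + a * (n ∸ k)                           ≤⟨ +-mono-≤ (*-monoˡ-≤ k card-link-∪⁅x⁆≤card-containing)
                                                                card-link-∪⁅x⁆*[n∸k]≤k*card-avoiding ⟩
      card-containing * k + k * card avoiding       ≡⟨ cong (_+ k * card avoiding) (*-comm card-containing k) ⟩
      k * card-containing + k * card avoiding       ≡⟨ *-distribˡ-+ k card-containing (card avoiding) ⟨
      k * (card-containing + card avoiding)         ≡⟨ cong (k *_) card-link≡card-containing+card-avoiding ⟨
      k * card (link (level C k) W)                 ∎
      where
      open ≤-Reasoning
      a = card (link (level C k) (W ∪ ⁅ x ⁆))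

  card-link-∪*n^d≤k^d*card-link : (d : ℕ) (W X : Subset N) → ∣ X ∣ ≡ d → Disjoint X W →
    card (link (level C k) (W ∪ X)) * n ^ d ≤ k ^ d * card (link (level C k) W)
  card-link-∪*n^d≤k^d*card-link zero W X ∣X∣≡0 _ rewrite ∣p∣≡0⇒p≡⊥ X ∣X∣≡0 | ∪-identityʳ W =
    ≤-reflexive (trans (*-identityʳ _) (sym (*-identityˡ _)))
  card-link-∪*n^d≤k^d*card-link (suc d) W X ∣X∣≡1+d X∩W≡∅
    with x , x∈X ← ∣p∣≡1+d⇒nonempty X ∣X∣≡1+d = begin
    card (L (W ∪ X)) * (n * n ^ d)       ≡⟨ cong (λ V → card (L V) * (n * n ^ d)) W∪X≡W′∪⁅x⁆ ⟩
    card (L (W′ ∪ ⁅ x ⁆)) * (n * n ^ d)  ≡⟨ *-assoc (card (L (W′ ∪ ⁅ x ⁆))) n (n ^ d) ⟨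
    card (L (W′ ∪ ⁅ x ⁆)) * n * n ^ d    ≤⟨ *-monoˡ-≤ (n ^ d) (card-link-∪⁅x⁆*n≤k*card-link W′ x∉W′) ⟩
    k * card (L W′) * n ^ d              ≡⟨ *-assoc k (card (L W′)) (n ^ d) ⟩
    k * (card (L W′) * n ^ d)            ≤⟨ *-monoʳ-≤ k (card-link-∪*n^d≤k^d*card-link d W (X - x) ∣X-x∣≡d
                                                          (X∩W≡∅ ∘ p─q⊆p X ⁅ x ⁆)) ⟩
    k * (k ^ d * card (L W))             ≡⟨ *-assoc k (k ^ d) (card (L W)) ⟨
    k * k ^ d * card (L W)               ∎
    where
    open ≤-Reasoning
    L = link (level C k)
    W′ = W ∪ (X - x)
    X-x∪⁅x⁆≡X = x∈p⇒[p-x]∪⁅x⁆≡p X x∈X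
    W∪X≡W′∪⁅x⁆ : W ∪ X ≡ W′ ∪ ⁅ x ⁆
    W∪X≡W′∪⁅x⁆ = trans (cong (W ∪_) (sym X-x∪⁅x⁆≡X)) (sym (∪-assoc W (X - x) ⁅ x ⁆))
    x∉W′ : x ∉ W′
    x∉W′ = [ X∩W≡∅ x∈X , x∉p-x X ] ∘ x∈p∪q⁻ W (X - x)
    ∣X-x∣≡d : ∣ X - x ∣ ≡ d
    ∣X-x∣≡d = suc-injective (begin-equality
      suc ∣ X - x ∣         ≡⟨ x∉p⇒∣p∪⁅x⁆∣≡1+∣p∣ (X - x) (x∉p-x X) ⟨
      ∣ (X - x) ∪ ⁅ x ⁆ ∣   ≡⟨ cong ∣_∣ X-x∪⁅x⁆≡X ⟩
      ∣ X ∣                 ≡⟨ ∣X∣≡1+d ⟩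
      suc d                 ∎)

lemma4 : (N n k : ℕ) → 1 ≤ N → 1 ≤ n → 1 ≤ k →
    (C : Family N) → IsSimplicialComplex C →
    ((A : Subset N) → IsMaximal C A → n ≤ ∣ A ∣) →
    IsRQSpread n k k (level C k)
lemma4 N n k _ _ _ C closed large S _ X with nonempty? (X ∩ S)
... | yes X∩S≢∅ rewrite card-empty _ (λ G → link-link-empty (level C k) S X G X∩S≢∅) = z≤n
... | no  X∩S≡∅ = begin
  card (link (link (level C k) S) X) * n ^ ∣ X ∣
    ≤⟨ *-monoˡ-≤ (n ^ ∣ X ∣) (card-mono-≤ (link-link⇒link-∪ (level C k) S X)) ⟩
  card (link (level C k) (S ∪ X)) * n ^ ∣ X ∣
    ≤⟨ card-link-∪*n^d≤k^d*card-link closed large ∣ X ∣ S X refl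
         (λ i∈X i∈S → X∩S≡∅ (_ , x∈p∩q⁺ (i∈X , i∈S))) ⟩
  k ^ ∣ X ∣ * card (link (level C k) S) ∎
  where open ≤-Reasoning
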